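{- Let $G$ be a graph. (1) Zero is a root of $\mathcal{P}(G;x)$ of multiplicity exactly $\gamma_P(G)$. (2) $\mathcal{P}(G;x)$ has no positive real roots. (3) Power domination polynomials may have non-real complex roots, i.e., there exist graphs whose power domination polynomial has a non-real root. (4) If $r$ is a rational real root of $\mathcal{P}(G;x)$, then $r$ is an integer.
   Context: Graphs are finite and simple with nonempty vertex set. For $S\subseteq V(G)$, $S$ is a power dominating set if, after coloring $S$, coloring every neighbor of a vertex of $S$, and then repeatedly applying the forcing rule (a colored vertex with exactly one uncolored neighbor colors that neighbor) until no changes occur, all vertices are colored. $\gamma_P(G)$ is the minimum size of a power dominating set. $\mathcal{P}(G;x)=\sum_{i=1}^{|V(G)|}p(G;i)x^i$, where $p(G;i)$ is the number of power dominating sets of size $i$. -}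

module Defs where

open import Data.Nat as ℕ using (ℕ; zero; suc; _<_; _≡ᵇ_)
open import Data.Bool using (Bool; true; false; _∧_; _∨_; not; if_then_else_)
open import Data.Fin using (Fin; zero; suc; _≟_)
open import Data.Fin.Subset using (Subset; ∣_∣)
open import Data.Vec using (Vec; []; _∷_; lookup; tabulate)
open import Data.List using (List; []; _∷_; _++_; map; length; filterᵇ)
open import Data.Product using (Σ; _×_; _,_; ∃; ∃-syntax)
open import Data.Integer using (ℤ; +_)
open import Data.Rational using (ℚ; _/_; _+_; _*_; _-_; _≤_; 0ℚ; 1ℚ) renaming (∣_∣ to abs)
open import Relation.Nullary using (¬_; ⌊_⌋)
open import Relation.Binary.PropositionalEquality using (_≡_)

record Graph (n : ℕ) : Set where
  field
    adj    : Fin n → Fin n → Bool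
    sym    : ∀ u v → adj u v ≡ adj v u
    irrefl : ∀ v → adj v v ≡ false
open Graph public

anyF : ∀ {n} → (Fin n → Bool) → Bool
anyF {zero}  f = false
anyF {suc n} f = f zero ∨ anyF (λ i → f (suc i))

allF : ∀ {n} → (Fin n → Bool) → Bool
allF {zero}  f = true
allF {suc n} f = f zero ∧ allF (λ i → f (suc i))

iter : ∀ {A : Set} → ℕ → (A → A) → A → A
iter zero    f a = a
iter (suc k) f a = f (iter k f a)

module _ {n : ℕ} (G : Graph n) where

  dominate : Subset n → Subset n
  dominate S = tabulate λ u → lookup S u ∨ anyF (λ v → lookup S v ∧ adj G v u)

  -- v (coloured) forces u: u is the unique uncoloured neighbour of v
  forces : Subset n → Fin n → Fin n → Bool
  forces C v u = lookup C v ∧ adj G v u ∧ not (lookup C u)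
                 ∧ allF (λ w → not (adj G v w) ∨ lookup C w ∨ ⌊ w ≟ u ⌋)

  forceStep : Subset n → Subset n
  forceStep C = tabulate λ u → lookup C u ∨ anyF (λ v → forces C v u)

  -- repeated forcing until stable; n rounds always suffice, since every
  -- non-stable round colours at least one new vertex
  closure : Subset n → Subset n
  closure S = iter n forceStep (dominate S)

  isPD : Subset n → Bool
  isPD S = allF (λ u → lookup (closure S) u)

  IsPowerDominatingSet : Subset n → Set
  IsPowerDominatingSet S = isPD S ≡ true

  IsPowerDominationNumber : ℕ → Set
  IsPowerDominationNumber k =
    (Σ (Subset n) λ S → IsPowerDominatingSet S × ∣ S ∣ ≡ k)
    × (∀ S → IsPowerDominatingSet S → k ℕ.≤ ∣ S ∣)

subsets : (n : ℕ) → List (Subset n)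
subsets zero    = [] ∷ []
subsets (suc n) = map (true ∷_) (subsets n) ++ map (false ∷_) (subsets n)

module _ {n : ℕ} (G : Graph n) where

  pdCount : ℕ → ℕ
  pdCount i = length (filterᵇ (λ S → isPD G S ∧ (∣ S ∣ ≡ᵇ i)) (subsets n))

  -- coefficient of x^i in 𝒫(G;x) = Σ_{i=1}^{n} p(G;i) x^i
  coeff : ℕ → ℕ
  coeff zero    = 0
  coeff (suc i) = pdCount (suc i)

ℕtoℚ : ℕ → ℚ
ℕtoℚ k = (+ k) / 1

_^ℚ_ : ℚ → ℕ → ℚ
x ^ℚ zero  = 1ℚ
x ^ℚ suc k = x * (x ^ℚ k)

sum1 : ℕ → (ℕ → ℚ) → ℚ
sum1 zero    f = 0ℚ
sum1 (suc m) f = sum1 m f + f (suc m)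

evalP : ∀ {n} → Graph n → ℚ → ℚ
evalP {n} G x = sum1 n (λ i → ℕtoℚ (pdCount G i) * (x ^ℚ i))

ℚi : Set
ℚi = ℚ × ℚ

_*ᵢ_ : ℚi → ℚi → ℚi
(a , b) *ᵢ (c , d) = (a * c - b * d , a * d + b * c)

_+ᵢ_ : ℚi → ℚi → ℚi
(a , b) +ᵢ (c , d) = (a + c , b + d)

_^ᵢ_ : ℚi → ℕ → ℚi
z ^ᵢ zero  = (1ℚ , 0ℚ)
z ^ᵢ suc k = z *ᵢ (z ^ᵢ k)

scaleᵢ : ℚ → ℚi → ℚi
scaleᵢ c (a , b) = (c * a , c * b)

sum1ᵢ : ℕ → (ℕ → ℚi) → ℚi
sum1ᵢ zero    f = (0ℚ , 0ℚ)
sum1ᵢ (suc m) f = sum1ᵢ m f +ᵢ f (suc m)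

evalPᵢ : ∀ {n} → Graph n → ℚi → ℚi
evalPᵢ {n} G z = sum1ᵢ n (λ i → scaleᵢ (ℕtoℚ (pdCount G i)) (z ^ᵢ i))

-- Real numbers as Cauchy sequences of rationals

eps : ℕ → ℚ
eps k = (+ 1) / suc k

IsCauchy : (ℕ → ℚ) → Set
IsCauchy x = ∀ k → ∃[ N ] ∀ m j → N ℕ.≤ m → N ℕ.≤ j → abs (x m - x j) ≤ eps k

TendsToZero : (ℕ → ℚ) → Set
TendsToZero y = ∀ k → ∃[ N ] ∀ m → N ℕ.≤ m → abs (y m) ≤ eps k

-- the real number lim x is > 0
EventuallyPositive : (ℕ → ℚ) → Set
EventuallyPositive x = ∃[ k ] ∃[ N ] ∀ m → N ℕ.≤ m → eps k ≤ x m

-- the real number lim x is ≠ 0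
EventuallyApart : (ℕ → ℚ) → Set
EventuallyApart x = ∃[ k ] ∃[ N ] ∀ m → N ℕ.≤ m → eps k ≤ abs (x m)

-- 𝒫(G;x) has a positive real root: a real r = lim x_m > 0 with 𝒫(G;r) = 0,
-- i.e. (by continuity) 𝒫(G;x_m) → 0
HasPositiveRealRoot : ∀ {n} → Graph n → Set
HasPositiveRealRoot G =
  Σ (ℕ → ℚ) λ x → IsCauchy x × EventuallyPositive x
                  × TendsToZero (λ m → evalP G (x m))

HasNonRealRoot : ∀ {n} → Graph n → Set
HasNonRealRoot G =
  Σ (ℕ → ℚ) λ a → Σ (ℕ → ℚ) λ b →
    IsCauchy a × IsCauchy b × EventuallyApart b
    × TendsToZero (λ m → Data.Product.proj₁ (evalPᵢ G (a m , b m)))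
    × TendsToZero (λ m → Data.Product.proj₂ (evalPᵢ G (a m , b m)))

ZeroRootMultiplicity : ∀ {n} → Graph n → ℕ → Set
ZeroRootMultiplicity G k = (∀ i → i < k → coeff G i ≡ 0) × ¬ (coeff G k ≡ 0)

IsInteger : ℚ → Set
IsInteger r = ∃[ z ] r ≡ z / 1

module Submission where

-- Two facts about power domination on a graph with n ≥ 1 vertices drive the
-- whole proof: the empty set is never power dominating (nothing is ever
-- coloured), and the full vertex set is power dominating and is the only set
-- of size n, so the leading coefficient p(G;n) is 1.
--
-- (1) Coefficients count subsets in the explicit list of all subsets: a
--     predicate false on every subset counts 0, one true on some subset counts
--     at least 1.  Minimality of γ_P kills p(G;i) for i < γ_P, a minimum set
--     makes p(G;γ_P) ≠ 0, and γ_P ≠ 0 because the empty set fails.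
-- (2) For x ≥ 0 all terms are nonnegative and the last one is xⁿ, so
--     𝒫(G;x) ≥ xⁿ; along a sequence eventually ≥ ε > 0 the values stay
--     ≥ εⁿ > 0 and cannot tend to 0.
-- (3) In the complete graph K₄ every nonempty set is power dominating, so
--     𝒫(K₄;x) = (1+x)⁴ - 1, which vanishes at -1 + i (checked by evaluation).
-- (4) The rational root theorem for integer polynomials with leading
--     coefficient 1: for a root p/q in lowest terms, clearing denominators
--     gives q ∣ pⁿ, and coprimality forces q = 1.

open import Defs hiding (sym)
open import Function using (_∘_)
open import Data.Bool using (Bool; true; false; not; _∧_; _∨_)
open import Data.Bool.Properties using (∧-zeroʳ)
open import Data.Nat as ℕ using (ℕ; zero; suc; _≡ᵇ_; z≤n; s≤s; _⊔_)
import Data.Nat.Properties as ℕP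
open import Data.Nat.Divisibility using (_∣_; divides; ∣1⇒≡1)
open import Data.Nat.Coprimality as Coprimality using (Coprime; coprime-divisor)
open import Data.Integer as ℤ using (ℤ; +_; +[1+_]; -[1+_])
import Data.Integer.Properties as ℤP
open import Data.Integer.Tactic.RingSolver using (solve-∀)
open import Data.Fin as Fin using (Fin; zero; suc)
open import Data.Fin.Subset using (Subset; ∣_∣; ⊤)
open import Data.Fin.Subset.Properties using (∣⊤∣≡n; ∣p∣≡n⇒p≡⊤)
open import Data.Vec using (_∷_; []; lookup; tabulate)
open import Data.Vec.Properties using (lookup∘tabulate; lookup-replicate; ∷-injectiveʳ)
open import Data.List using (List; []; _∷_; _++_; map; length; filterᵇ)
open import Data.List.Properties using (filter-++; length-++)
open import Data.Product using (Σ; _×_; _,_; proj₁; proj₂; ∃-syntax)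
open import Data.Rational
  using (ℚ; mkℚ; 0ℚ; 1ℚ; -_; _+_; _*_; _/_; _≤_; _<_; *<*; *≤*; toℚᵘ; nonNegative; positive)
  renaming (∣_∣ to abs)
open import Data.Rational.Properties
open import Data.Rational.Unnormalised as ℚᵘ using (mkℚᵘ; *≡*)
import Data.Rational.Unnormalised.Properties as ℚᵘP
import Data.Rational.Solver as ℚSolver
open import Relation.Nullary using (¬_; yes; no; ⌊_⌋; contradiction)
open import Relation.Nullary.Decidable using (dec-true; dec-false; isYes≗does; recompute)
open import Relation.Binary.PropositionalEquality

count : {A : Set} → (A → Bool) → List A → ℕ
count p xs = length (filterᵇ p xs)

count-++ : {A : Set} (p : A → Bool) (xs ys : List A) →
           count p (xs ++ ys) ≡ count p xs ℕ.+ count p ys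
count-++ p xs ys = trans (cong length (filter-++ _ xs ys)) (length-++ (filterᵇ p xs))

count-map : {A B : Set} (p : B → Bool) (g : A → B) (xs : List A) →
            count p (map g xs) ≡ count (p ∘ g) xs
count-map p g []       = refl
count-map p g (x ∷ xs) with p (g x)
... | true  = cong suc (count-map p g xs)
... | false = count-map p g xs

count-subsets : ∀ m (p : Subset (suc m) → Bool) →
                count p (subsets (suc m))
                  ≡ count (p ∘ (true ∷_)) (subsets m) ℕ.+ count (p ∘ (false ∷_)) (subsets m)
count-subsets m p =
  trans (count-++ p (map (true ∷_) (subsets m)) (map (false ∷_) (subsets m)))
        (cong₂ ℕ._+_ (count-map p (true ∷_) (subsets m)) (count-map p (false ∷_) (subsets m)))

count-none : {A : Set} (p : A → Bool) (xs : List A) → (∀ x → p x ≡ false) → count p xs ≡ 0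
count-none p []       none = refl
count-none p (x ∷ xs) none rewrite none x = count-none p xs none

-- every subset occurs in subsets m, so a satisfied predicate is counted
count-some : ∀ m (p : Subset m → Bool) (S : Subset m) → p S ≡ true → 1 ℕ.≤ count p (subsets m)
count-some zero    p []          pS rewrite pS = s≤s z≤n
count-some (suc m) p (true ∷ S)  pS rewrite count-subsets m p =
  ℕP.≤-trans (count-some m (p ∘ (true ∷_)) S pS) (ℕP.m≤m+n _ _)
count-some (suc m) p (false ∷ S) pS rewrite count-subsets m p =
  ℕP.≤-trans (count-some m (p ∘ (false ∷_)) S pS) (ℕP.m≤n+m _ _)

count-unique : ∀ m (p : Subset m → Bool) (T : Subset m) →
               p T ≡ true → (∀ S → S ≢ T → p S ≡ false) → count p (subsets m) ≡ 1
count-unique zero    p []          pT others rewrite pT = refl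
count-unique (suc m) p (true ∷ T)  pT others rewrite count-subsets m p =
  cong₂ ℕ._+_ (count-unique m _ T pT (λ S S≢T → others _ (S≢T ∘ ∷-injectiveʳ)))
              (count-none (p ∘ (false ∷_)) (subsets m) (λ S → others _ λ ()))
count-unique (suc m) p (false ∷ T) pT others rewrite count-subsets m p =
  cong₂ ℕ._+_ (count-none (p ∘ (true ∷_)) (subsets m) (λ S → others _ λ ()))
              (count-unique m _ T pT (λ S S≢T → others _ (S≢T ∘ ∷-injectiveʳ)))

anyF-false : ∀ {n} (f : Fin n → Bool) → (∀ i → f i ≡ false) → anyF f ≡ false
anyF-false {zero}  f all-false = refl
anyF-false {suc n} f all-false rewrite all-false zero = anyF-false (f ∘ suc) (all-false ∘ suc)

allF-true : ∀ {n} (f : Fin n → Bool) → (∀ i → f i ≡ true) → allF f ≡ true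
allF-true {zero}  f all-true = refl
allF-true {suc n} f all-true rewrite all-true zero = allF-true (f ∘ suc) (all-true ∘ suc)

allF-true⁻¹ : ∀ {n} (f : Fin n → Bool) → allF f ≡ true → ∀ i → f i ≡ true
allF-true⁻¹ {suc n} f all-true i with f zero in f0
allF-true⁻¹ {suc n} f all-true zero    | true = f0
allF-true⁻¹ {suc n} f all-true (suc i) | true = allF-true⁻¹ (f ∘ suc) all-true i

false-∧ : ∀ {b c} → b ≡ false → (b ∧ c) ≡ false
false-∧ refl = refl

iter-preserves : {A : Set} (P : A → Set) (f : A → A) →
                 (∀ {a} → P a → P (f a)) → ∀ k {a} → P a → P (iter k f a)
iter-preserves P f step zero    Pa = Pa
iter-preserves P f step (suc k) Pa = step (iter-preserves P f step k Pa)

size-zero-empty : ∀ {m} (S : Subset m) → ∣ S ∣ ≡ 0 → ∀ u → lookup S u ≡ false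
size-zero-empty (false ∷ S) ∣S∣≡0 zero    = refl
size-zero-empty (false ∷ S) ∣S∣≡0 (suc u) = size-zero-empty S ∣S∣≡0 u

module _ {n : ℕ} (G : Graph n) where

  AllColoured : Subset n → Set
  AllColoured C = ∀ u → lookup C u ≡ true

  NoneColoured : Subset n → Set
  NoneColoured C = ∀ u → lookup C u ≡ false

  -- forcing never uncolours a vertex ...
  forceStep-all : ∀ {C} → AllColoured C → AllColoured (forceStep G C)
  forceStep-all {C} all u
    rewrite lookup∘tabulate (λ u → lookup C u ∨ anyF (λ v → forces G C v u)) u | all u = refl

  -- ... and only coloured vertices can force
  forceStep-none : ∀ {C} → NoneColoured C → NoneColoured (forceStep G C)
  forceStep-none {C} none u
    rewrite lookup∘tabulate (λ u → lookup C u ∨ anyF (λ v → forces G C v u)) u | none u =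
    anyF-false _ (λ v → false-∧ (none v))

  ⊤-isPD : IsPowerDominatingSet G ⊤
  ⊤-isPD = allF-true _
    (iter-preserves AllColoured (forceStep G) (λ {C} → forceStep-all {C}) n dominate-⊤)
    where
    dominate-⊤ : AllColoured (dominate G ⊤)
    dominate-⊤ u
      rewrite lookup∘tabulate (λ u → lookup ⊤ u ∨ anyF (λ v → lookup ⊤ v ∧ adj G v u)) u
            | lookup-replicate u true = refl

  closure-of-empty : ∀ S → ∣ S ∣ ≡ 0 → NoneColoured (closure G S)
  closure-of-empty S ∣S∣≡0 =
    iter-preserves NoneColoured (forceStep G) (λ {C} → forceStep-none {C}) n dominate-∅
    where
    empty : ∀ u → lookup S u ≡ false
    empty = size-zero-empty S ∣S∣≡0
    dominate-∅ : NoneColoured (dominate G S)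
    dominate-∅ u
      rewrite lookup∘tabulate (λ u → lookup S u ∨ anyF (λ v → lookup S v ∧ adj G v u)) u
            | empty u = anyF-false _ (λ v → false-∧ (empty v))

  -- the full vertex set is the only set of size n, so p(G;n) = 1
  pdCount-full : pdCount G n ≡ 1
  pdCount-full = count-unique n _ (⊤ {n}) full-counted others
    where
    full-counted : (isPD G ⊤ ∧ (∣ ⊤ {n} ∣ ≡ᵇ n)) ≡ true
    full-counted = trans (cong (_∧ (∣ ⊤ {n} ∣ ≡ᵇ n)) ⊤-isPD) full-size
      where
      full-size : (∣ ⊤ {n} ∣ ≡ᵇ n) ≡ true
      full-size = dec-true (∣ ⊤ {n} ∣ ℕ.≟ n) (∣⊤∣≡n n)
    others : ∀ S → S ≢ ⊤ {n} → (isPD G S ∧ (∣ S ∣ ≡ᵇ n)) ≡ false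
    others S S≢⊤ = trans (cong (isPD G S ∧_) (dec-false (∣ S ∣ ℕ.≟ n) (S≢⊤ ∘ ∣p∣≡n⇒p≡⊤)))
                         (∧-zeroʳ _)

-- with at least one vertex, the empty set leaves that vertex uncoloured
empty-not-PD : ∀ {n} (G : Graph (suc n)) S → ∣ S ∣ ≡ 0 → ¬ IsPowerDominatingSet G S
empty-not-PD G S ∣S∣≡0 S-pd
  with trans (sym (allF-true⁻¹ (lookup (closure G S)) S-pd zero)) (closure-of-empty G S ∣S∣≡0 zero)
... | ()

zero-root-multiplicity : ∀ {n} (G : Graph (suc n)) (k : ℕ) →
                         IsPowerDominationNumber G k → ZeroRootMultiplicity G k
zero-root-multiplicity G k ((S , S-pd , ∣S∣≡k) , minimal) = vanish-below , nonzero-at k ∣S∣≡k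
  where
  -- minimality: there is no power dominating set of size below k
  vanish-below : ∀ i → i ℕ.< k → coeff G i ≡ 0
  vanish-below zero    _   = refl
  vanish-below (suc i) i<k = count-none _ (subsets _) none-of-size
    where
    none-of-size : ∀ X → (isPD G X ∧ (∣ X ∣ ≡ᵇ suc i)) ≡ false
    none-of-size X with isPD G X in X-pd
    ... | false = refl
    ... | true  = dec-false (∣ X ∣ ℕ.≟ suc i)
                    (λ ∣X∣≡ → ℕP.<⇒≱ i<k (subst (k ℕ.≤_) ∣X∣≡ (minimal X X-pd)))
  -- S is counted in p(G;k), and k ≠ 0 as the empty set is not power dominating
  nonzero-at : ∀ j → ∣ S ∣ ≡ j → coeff G j ≢ 0
  nonzero-at zero    ∣S∣≡0 _   = empty-not-PD G S ∣S∣≡0 S-pd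
  nonzero-at (suc j) ∣S∣≡j p≡0 =
    contradiction (subst (1 ℕ.≤_) p≡0 (count-some _ _ S S-counted)) λ ()
    where
    S-counted : (isPD G S ∧ (∣ S ∣ ≡ᵇ suc j)) ≡ true
    S-counted = trans (cong (_∧ _) S-pd) (dec-true (∣ S ∣ ℕ.≟ suc j) ∣S∣≡j)

fromℤ : ℤ → ℚ
fromℤ a = a / 1

-- evalP G x is definitionally poly n (λ i → + pdCount G i) x
poly : ℕ → (ℕ → ℤ) → ℚ → ℚ
poly m a x = sum1 m (λ i → fromℤ (a i) * (x ^ℚ i))

0<eps : ∀ k → 0ℚ < eps k
0<eps k = positive⁻¹ (eps k) {{normalize-pos 1 (suc k)}}

-- Archimedean property in the form needed for the limit notions of Defs
eps-below : ∀ c → 0ℚ < c → ∃[ j ] eps j < c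
eps-below (mkℚ +[1+ a ] d _) _ =
  suc d , toℚᵘ-cancel-< (ℚᵘP.<-respˡ-≃ (ℚᵘP.≃-sym (toℚᵘ-fromℚᵘ (mkℚᵘ (+ 1) (suc d)))) 1/d+2<c)
  where
  1/d+2<c : mkℚᵘ (+ 1) (suc d) ℚᵘ.< mkℚᵘ +[1+ a ] d
  1/d+2<c = ℚᵘ.*<* (ℤ.+<+ (s≤s (s≤s (ℕP.+-monoʳ-≤ d z≤n))))
eps-below (mkℚ (+ 0) d _)    (*<* (ℤ.+<+ ()))
eps-below (mkℚ -[1+ a ] d _) (*<* ())

pow-nonneg : ∀ y → 0ℚ ≤ y → ∀ i → 0ℚ ≤ y ^ℚ i
pow-nonneg y 0≤y zero    = *≤* (ℤ.+≤+ z≤n)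
pow-nonneg y 0≤y (suc i) = nonNegative⁻¹ _
  {{nonNeg*nonNeg⇒nonNeg y {{nonNegative 0≤y}} _ {{nonNegative (pow-nonneg y 0≤y i)}}}}

pow-pos : ∀ y → 0ℚ < y → ∀ i → 0ℚ < y ^ℚ i
pow-pos y 0<y zero    = *<* (ℤ.+<+ (s≤s z≤n))
pow-pos y 0<y (suc i) = positive⁻¹ _
  {{pos*pos⇒pos y {{positive 0<y}} _ {{positive (pow-pos y 0<y i)}}}}

pow-mono : ∀ {a b} → 0ℚ ≤ a → a ≤ b → ∀ i → a ^ℚ i ≤ b ^ℚ i
pow-mono 0≤a a≤b zero    = ≤-refl
pow-mono {a} {b} 0≤a a≤b (suc i) =
  ≤-trans (*-monoʳ-≤-nonNeg (a ^ℚ i) {{nonNegative (pow-nonneg a 0≤a i)}} a≤b)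
          (*-monoˡ-≤-nonNeg b {{nonNegative (≤-trans 0≤a a≤b)}} (pow-mono 0≤a a≤b i))

sum-nonneg : ∀ m f → (∀ i → 0ℚ ≤ f i) → 0ℚ ≤ sum1 m f
sum-nonneg zero    f nonneg = ≤-refl
sum-nonneg (suc m) f nonneg = +-mono-≤ (sum-nonneg m f nonneg) (nonneg (suc m))

last-≤-sum : ∀ m f → (∀ i → 0ℚ ≤ f i) → f (suc m) ≤ sum1 (suc m) f
last-≤-sum m f nonneg =
  subst (_≤ sum1 (suc m) f) (+-identityˡ (f (suc m))) (+-monoˡ-≤ (f (suc m)) (sum-nonneg m f nonneg))

monic-lower-bound : ∀ m (c : ℕ → ℕ) → c (suc m) ≡ 1 →
                    ∀ x → 0ℚ ≤ x → x ^ℚ suc m ≤ poly (suc m) (λ i → + c i) x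
monic-lower-bound m c lead x 0≤x =
  subst (_≤ poly (suc m) (λ i → + c i) x) leading-term (last-≤-sum m _ term-nonneg)
  where
  term-nonneg : ∀ i → 0ℚ ≤ fromℤ (+ c i) * (x ^ℚ i)
  term-nonneg i = nonNegative⁻¹ _
    {{nonNeg*nonNeg⇒nonNeg (fromℤ (+ c i)) {{normalize-nonNeg (c i) 1}}
                           _ {{nonNegative (pow-nonneg x 0≤x i)}}}}
  leading-term : fromℤ (+ c (suc m)) * (x ^ℚ suc m) ≡ x ^ℚ suc m
  leading-term = trans (cong (λ k → fromℤ (+ k) * (x ^ℚ suc m)) lead) (*-identityˡ _)

bounded-away : ∀ (y : ℕ → ℚ) b → 0ℚ < b → (∃[ N ] ∀ m → N ℕ.≤ m → b ≤ y m) → ¬ TendsToZero y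
bounded-away y b 0<b (N₁ , above) tends with eps-below b 0<b
... | j , eps<b with tends j
... | N₂ , small = <-irrefl refl (<-≤-trans eps<b (≤-trans (above m (ℕP.m≤m⊔n N₁ N₂)) ym≤eps))
  where
  m : ℕ
  m = N₁ ⊔ N₂
  ym≤eps : y m ≤ eps j
  ym≤eps = subst (_≤ eps j)
    (0≤p⇒∣p∣≡p (≤-trans (<⇒≤ 0<b) (above m (ℕP.m≤m⊔n N₁ N₂)))) (small m (ℕP.m≤n⊔m N₁ N₂))

-- if x_k ≥ ε > 0 eventually, then poly(x_k) ≥ εᵐ eventually
monic-no-positive-root : ∀ m (c : ℕ → ℕ) → c (suc m) ≡ 1 → (x : ℕ → ℚ) →
                         EventuallyPositive x → ¬ TendsToZero (λ k → poly (suc m) (λ i → + c i) (x k))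
monic-no-positive-root m c lead x (k , N , ε≤x) =
  bounded-away _ (eps k ^ℚ suc m) (pow-pos _ (0<eps k) (suc m)) (N , above)
  where
  above : ∀ j → N ℕ.≤ j → eps k ^ℚ suc m ≤ poly (suc m) (λ i → + c i) (x j)
  above j N≤j = ≤-trans (pow-mono (<⇒≤ (0<eps k)) (ε≤x j N≤j) (suc m))
    (monic-lower-bound m c lead (x j) (≤-trans (<⇒≤ (0<eps k)) (ε≤x j N≤j)))

-- ⌊ u ≟ v ⌋ is symmetric and reflexive, so "u ≠ v" is a simple graph
isYes-sym : ∀ {n} (u v : Fin n) → ⌊ u Fin.≟ v ⌋ ≡ ⌊ v Fin.≟ u ⌋
isYes-sym u v with u Fin.≟ v
... | yes refl = sym (trans (isYes≗does (u Fin.≟ u)) (dec-true (u Fin.≟ u) refl))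
... | no  u≢v  = sym (trans (isYes≗does (v Fin.≟ u)) (dec-false (v Fin.≟ u) (u≢v ∘ sym)))

isYes-refl : ∀ {n} (v : Fin n) → ⌊ v Fin.≟ v ⌋ ≡ true
isYes-refl v = trans (isYes≗does (v Fin.≟ v)) (dec-true (v Fin.≟ v) refl)

complete : ∀ n → Graph n
complete n = record
  { adj    = λ u v → not ⌊ u Fin.≟ v ⌋
  ; sym    = λ u v → cong not (isYes-sym u v)
  ; irrefl = λ v → cong not (isYes-refl v)
  }

-- 𝒫(K₄;x) = 4x + 6x² + 4x³ + x⁴ = (1+x)⁴ - 1 vanishes at -1 + i
K₄-root : evalPᵢ (complete 4) (- 1ℚ , 1ℚ) ≡ (0ℚ , 0ℚ)
K₄-root = refl

-- constant sequences are Cauchy and the zero sequence tends to 0, so an exact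
-- root is a root in the limit sense of Defs
constant-isCauchy : ∀ c → IsCauchy (λ _ → c)
constant-isCauchy c k =
  0 , λ _ _ _ _ → subst (_≤ eps k) (sym (cong abs (+-inverseʳ c))) (<⇒≤ (0<eps k))

zero-tendsToZero : ∀ y → (∀ m → y m ≡ 0ℚ) → TendsToZero y
zero-tendsToZero y zero-seq k =
  0 , λ m _ → subst (λ z → abs z ≤ eps k) (sym (zero-seq m)) (<⇒≤ (0<eps k))

K₄-nonreal-root : HasNonRealRoot (complete 4)
K₄-nonreal-root =
  (λ _ → - 1ℚ) , (λ _ → 1ℚ) , constant-isCauchy (- 1ℚ) , constant-isCauchy 1ℚ , (0 , 0 , λ _ _ → ≤-refl)
  , zero-tendsToZero _ (λ _ → cong proj₁ K₄-root) , zero-tendsToZero _ (λ _ → cong proj₂ K₄-root)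

fromℤ-toℚᵘ : ∀ a → toℚᵘ (fromℤ a) ℚᵘ.≃ mkℚᵘ a 0
fromℤ-toℚᵘ a = toℚᵘ-fromℚᵘ (mkℚᵘ a 0)

fromℤ-+ : ∀ a b → fromℤ (a ℤ.+ b) ≡ fromℤ a + fromℤ b
fromℤ-+ a b = toℚᵘ-injective (ℚᵘP.≃-trans (fromℤ-toℚᵘ (a ℤ.+ b)) (ℚᵘP.≃-trans (*≡* (lemma a b))
  (ℚᵘP.≃-trans (ℚᵘP.+-cong (ℚᵘP.≃-sym (fromℤ-toℚᵘ a)) (ℚᵘP.≃-sym (fromℤ-toℚᵘ b)))
               (ℚᵘP.≃-sym (toℚᵘ-homo-+ (fromℤ a) (fromℤ b))))))
  where
  lemma : ∀ a b → (a ℤ.+ b) ℤ.* + 1 ≡ (a ℤ.* + 1 ℤ.+ b ℤ.* + 1) ℤ.* + 1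
  lemma = solve-∀

fromℤ-* : ∀ a b → fromℤ (a ℤ.* b) ≡ fromℤ a * fromℤ b
fromℤ-* a b = toℚᵘ-injective (ℚᵘP.≃-trans (fromℤ-toℚᵘ (a ℤ.* b))
  (ℚᵘP.≃-trans (ℚᵘP.*-cong (ℚᵘP.≃-sym (fromℤ-toℚᵘ a)) (ℚᵘP.≃-sym (fromℤ-toℚᵘ b)))
               (ℚᵘP.≃-sym (toℚᵘ-homo-* (fromℤ a) (fromℤ b)))))

fromℤ-injective : ∀ a b → fromℤ a ≡ fromℤ b → a ≡ b
fromℤ-injective a b eq
  with ℚᵘP.≃-trans (ℚᵘP.≃-sym (fromℤ-toℚᵘ a)) (ℚᵘP.≃-trans (toℚᵘ-cong eq) (fromℤ-toℚᵘ b))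
... | *≡* a*1≡b*1 = trans (sym (ℤP.*-identityʳ a)) (trans a*1≡b*1 (ℤP.*-identityʳ b))

fromℤ-^ : ∀ p i → fromℤ (p ℤ.^ i) ≡ fromℤ p ^ℚ i
fromℤ-^ p zero    = refl
fromℤ-^ p (suc i) = trans (fromℤ-* p (p ℤ.^ i)) (cong (fromℤ p *_) (fromℤ-^ p i))

times-denominator : ∀ p d .(c : Coprime ℤ.∣ p ∣ (suc d)) → mkℚ p d c * fromℤ (+ suc d) ≡ fromℤ p
times-denominator p d c = toℚᵘ-injective (ℚᵘP.≃-trans (toℚᵘ-homo-* (mkℚ p d c) (fromℤ (+ suc d)))
  (ℚᵘP.≃-trans (ℚᵘP.*-cong (ℚᵘP.≃-refl {mkℚᵘ p d}) (fromℤ-toℚᵘ (+ suc d)))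
  (ℚᵘP.≃-trans (*≡* (lemma p (+ suc d))) (ℚᵘP.≃-sym (fromℤ-toℚᵘ p)))))
  where
  lemma : ∀ x y → (x ℤ.* y) ℤ.* + 1 ≡ x ℤ.* (y ℤ.* + 1)
  lemma = solve-∀

pow-* : ∀ x y i → (x ^ℚ i) * (y ^ℚ i) ≡ (x * y) ^ℚ i
pow-* x y zero    = *-identityˡ 1ℚ
pow-* x y (suc i) = trans (interchange x y (x ^ℚ i) (y ^ℚ i)) (cong ((x * y) *_) (pow-* x y i))
  where
  open ℚSolver.+-*-Solver
  interchange : ∀ a b c e → (a * c) * (b * e) ≡ (a * b) * (c * e)
  interchange = solve 4 (λ a b c e → (a :* c) :* (b :* e) := (a :* b) :* (c :* e)) refl

module ClearDenominators (a : ℕ → ℤ) (p : ℤ) (q : ℕ) where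

  -- Σ_{i ≤ m} aᵢ pⁱ q^(m-i), by Horner-like recursion
  cleared : ℕ → ℤ
  cleared zero    = + 0
  cleared (suc m) = cleared m ℤ.* + q ℤ.+ a (suc m) ℤ.* p ℤ.^ suc m

  clear : ∀ r → r * fromℤ (+ q) ≡ fromℤ p → ∀ m → poly m a r * (fromℤ (+ q) ^ℚ m) ≡ fromℤ (cleared m)
  clear r rq≡p zero    = *-zeroˡ 1ℚ
  clear r rq≡p (suc m) = begin
      (poly m a r + A * (r ^ℚ suc m)) * (Q * (Q ^ℚ m))
    ≡⟨ distribute (poly m a r) A (r ^ℚ suc m) Q (Q ^ℚ m) ⟩
      (poly m a r * (Q ^ℚ m)) * Q + A * ((r ^ℚ suc m) * (Q ^ℚ suc m))
    ≡⟨ cong₂ (λ s t → s * Q + A * t) (clear r rq≡p m) leading ⟩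
      fromℤ (cleared m) * Q + A * fromℤ (p ℤ.^ suc m)
    ≡⟨ sym (cong₂ _+_ (fromℤ-* (cleared m) (+ q)) (fromℤ-* (a (suc m)) (p ℤ.^ suc m))) ⟩
      fromℤ (cleared m ℤ.* + q) + fromℤ (a (suc m) ℤ.* p ℤ.^ suc m)
    ≡⟨ sym (fromℤ-+ (cleared m ℤ.* + q) (a (suc m) ℤ.* p ℤ.^ suc m)) ⟩
      fromℤ (cleared (suc m)) ∎
    where
    open ≡-Reasoning
    open ℚSolver.+-*-Solver using (solve; _:+_; _:*_; _:=_)
    Q A : ℚ
    Q = fromℤ (+ q)
    A = fromℤ (a (suc m))
    distribute : ∀ S C R Q QM → (S + C * R) * (Q * QM) ≡ (S * QM) * Q + C * (R * (Q * QM))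
    distribute = solve 5 (λ S C R Q QM →
      (S :+ C :* R) :* (Q :* QM) := (S :* QM) :* Q :+ C :* (R :* (Q :* QM))) refl
    leading : (r ^ℚ suc m) * (Q ^ℚ suc m) ≡ fromℤ (p ℤ.^ suc m)
    leading = trans (pow-* r Q (suc m)) (trans (cong (_^ℚ suc m) rq≡p) (sym (fromℤ-^ p (suc m))))

divides-complement : ∀ x q y → x ℤ.* + q ℤ.+ y ≡ + 0 → q ∣ ℤ.∣ y ∣
divides-complement x q y sum≡0 = divides ℤ.∣ x ∣ (begin
    ℤ.∣ y ∣                          ≡⟨ cong ℤ.∣_∣ y≡-xq ⟩
    ℤ.∣ ℤ.- (x ℤ.* + q) ∣            ≡⟨ ℤP.∣-i∣≡∣i∣ (x ℤ.* + q) ⟩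
    ℤ.∣ x ℤ.* + q ∣                  ≡⟨ ℤP.abs-* x (+ q) ⟩
    ℤ.∣ x ∣ ℕ.* q                    ∎)
  where
  open ≡-Reasoning
  regroup : ∀ s y → y ≡ (s ℤ.+ y) ℤ.+ ℤ.- s
  regroup = solve-∀
  y≡-xq : y ≡ ℤ.- (x ℤ.* + q)
  y≡-xq = trans (regroup (x ℤ.* + q) y) (trans (cong (ℤ._+ ℤ.- (x ℤ.* + q)) sum≡0) (ℤP.+-identityˡ _))

coprime-power-divisor : ∀ p {q} → Coprime ℤ.∣ p ∣ q → ∀ i → q ∣ ℤ.∣ p ℤ.^ i ∣ → q ∣ 1
coprime-power-divisor p c zero    q∣1    = q∣1
coprime-power-divisor p c (suc i) q∣pⁱ⁺¹ = coprime-power-divisor p c i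
  (coprime-divisor (Coprimality.sym c) (subst (_ ∣_) (ℤP.abs-* p (p ℤ.^ i)) q∣pⁱ⁺¹))

monic-rational-root : ∀ m (a : ℕ → ℤ) → a (suc m) ≡ + 1 →
                      ∀ r → poly (suc m) a r ≡ 0ℚ → IsInteger r
monic-rational-root m a lead (mkℚ p d c) root =
  integral (ℕP.suc-injective (∣1⇒≡1 (coprime-power-divisor p coprime (suc m) q∣pᵐ)))
  where
  open ClearDenominators a p (suc d)
  coprime : Coprime ℤ.∣ p ∣ (suc d)
  coprime = recompute (Coprimality.coprime? _ _) c
  cleared≡0 : cleared (suc m) ≡ + 0
  cleared≡0 = fromℤ-injective _ _ (begin
      fromℤ (cleared (suc m))
    ≡⟨ sym (clear (mkℚ p d c) (times-denominator p d c) (suc m)) ⟩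
      poly (suc m) a (mkℚ p d c) * (fromℤ (+ suc d) ^ℚ suc m)
    ≡⟨ cong (_* (fromℤ (+ suc d) ^ℚ suc m)) root ⟩
      0ℚ * (fromℤ (+ suc d) ^ℚ suc m)
    ≡⟨ *-zeroˡ (fromℤ (+ suc d) ^ℚ suc m) ⟩
      0ℚ ∎)
    where open ≡-Reasoning
  q∣pᵐ : suc d ∣ ℤ.∣ p ℤ.^ suc m ∣
  q∣pᵐ = divides-complement (cleared m) (suc d) (p ℤ.^ suc m)
    (trans (cong (λ l → cleared m ℤ.* + suc d ℤ.+ l) (sym leading-term)) cleared≡0)
    where
    leading-term : a (suc m) ℤ.* p ℤ.^ suc m ≡ p ℤ.^ suc m
    leading-term = trans (cong (ℤ._* _) lead) (ℤP.*-identityˡ _)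
  integral : d ≡ 0 → IsInteger (mkℚ p d c)
  integral refl = p , sym (↥p/↧p≡p (mkℚ p 0 c))

proposition28 : ((n : ℕ) (G : Graph (suc n)) (k : ℕ) → IsPowerDominationNumber G k → ZeroRootMultiplicity G k)
    × ((n : ℕ) (G : Graph (suc n)) → ¬ HasPositiveRealRoot G)
    × (Σ ℕ λ n → Σ (Graph (suc n)) λ G → HasNonRealRoot G)
    × ((n : ℕ) (G : Graph (suc n)) (r : ℚ) → evalP G r ≡ 0ℚ → IsInteger r)
proposition28 =
    (λ n G → zero-root-multiplicity G)
  , (λ n G (x , _ , eventually-positive , tends) →
       monic-no-positive-root n (pdCount G) (pdCount-full G) x eventually-positive tends)
  , (3 , complete 4 , K₄-nonreal-root)
  , (λ n G → monic-rational-root n (λ i → + pdCount G i) (cong +_ (pdCount-full G)))
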